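{- Let $h=(h_1,\ldots,h_n)$ be a Hessenberg function. For each $i\in\{1,\ldots,n\}$, the polynomial $e_{h_i}(1,\ldots,h_i)=x_1x_2\cdots x_{h_i}$ lies in the ideal $I_h^{AD}$.
   Context: A Hessenberg function is an $n$-tuple $h=(h_1,\ldots,h_n)$ of integers with $i\le h_i\le n$ for all $i$ and $h_i\le h_{i+1}$ for $1\le i\le n-1$. For $S\subseteq\{1,\ldots,n\}$, $e_d(S)$ is the sum of all squarefree monomials of degree $d$ in $x_i$, $i\in S$ (with $e_0(S)=1$, $e_d(S)=0$ for $d<0$ or $d>|S|$), and $e_d(1,\ldots,m)$ means $S=\{1,\ldots,m\}$. The antidiagonal ideal $I_h^{AD}$ is the ideal of $\mathbb{Z}[x_1,\ldots,x_n]$ generated by $e_{h_i-(i-1)}(1,\ldots,h_i)$ for $i=1,\ldots,n$. -}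

module Defs where

open import Data.Nat as ℕ using (ℕ; zero; suc; _≤_; _∸_)
open import Data.Integer as ℤ using (ℤ; 0ℤ; 1ℤ)
open import Data.Fin as Fin using (Fin; toℕ)
open import Data.Vec as Vec using (Vec; zipWith; replicate; updateAt)
open import Data.Vec.Properties using (≡-dec)
open import Data.List as List using (List; []; _∷_; _++_; concatMap; map; take; allFin; foldr)
open import Data.Product using (_×_; _,_; Σ)
open import Relation.Nullary using (yes; no)
open import Relation.Binary.PropositionalEquality using (_≡_)

-- Monomials in x_1..x_n: exponent vectors (coordinate j ↔ variable x_{j+1}).
Mono : ℕ → Set
Mono n = Vec ℕ n

-- Polynomials in ℤ[x_1..x_n]: formal finite sums of terms c·x^m
-- (duplicates allowed; identified by coefficients, see _≈P_).
Poly : ℕ → Set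
Poly n = List (ℤ × Mono n)

module _ {n : ℕ} where

  0P : Poly n
  0P = []

  1P : Poly n
  1P = (1ℤ , replicate n 0) ∷ []

  var : Fin n → Poly n
  var j = (1ℤ , updateAt (replicate n 0) j (λ _ → 1)) ∷ []

  infixl 6 _+P_
  infixl 7 _*P_

  _+P_ : Poly n → Poly n → Poly n
  p +P q = p ++ q

  _*P_ : Poly n → Poly n → Poly n
  p *P q = concatMap (λ { (a , m) → map (λ { (b , m′) → (a ℤ.* b , zipWith ℕ._+_ m m′) }) q }) p

  coeff : Poly n → Mono n → ℤ
  coeff [] m = 0ℤ
  coeff ((a , m′) ∷ p) m with ≡-dec ℕ._≟_ m′ m
  ... | yes _ = a ℤ.+ coeff p m
  ... | no  _ = coeff p m

  infix 4 _≈P_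
  _≈P_ : Poly n → Poly n → Set
  p ≈P q = ∀ m → coeff p m ≡ coeff q m

  -- e_d(S) for S given as a (duplicate-free) list of variable indices:
  -- sum of all squarefree monomials of degree d in the variables of S.
  esym : ℕ → List (Fin n) → Poly n
  esym zero      _        = 1P
  esym (suc d)   []       = 0P
  esym (suc d)   (j ∷ js) = esym (suc d) js +P (var j *P esym d js)

  e : ℕ → ℕ → Poly n
  e d m = esym d (take m (allFin n))

  ΣP : ∀ {k} → (Fin k → Poly n) → Poly n
  ΣP {k} f = foldr (λ j acc → f j +P acc) 0P (allFin k)

  InIdeal : ∀ {k} → (Fin k → Poly n) → Poly n → Set
  InIdeal {k} g f = Σ (Fin k → Poly n) λ c → f ≈P ΣP (λ j → c j *P g j)

-- Hessenberg function h = (h_1,…,h_n), stored 0-indexed: h i = h_{i+1}.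
record IsHessenberg (n : ℕ) (h : Fin n → ℕ) : Set where
  field
    lower : ∀ i → suc (toℕ i) ≤ h i
    upper : ∀ i → h i ≤ n
    mono  : ∀ i → (p : suc (toℕ i) ℕ.< n) →
            h i ≤ h (Fin.fromℕ< p)

-- generators of the antidiagonal ideal: e_{h_i-(i-1)}(1,…,h_i), 1-indexed i;
-- with 0-indexed i this is e_{h i ∸ toℕ i}(1,…,h i) (no truncation since h i ≥ toℕ i + 1).
ADgen : (n : ℕ) → (Fin n → ℕ) → Fin n → Poly n
ADgen n h i = e (h i ∸ toℕ i) (h i)

IAD : (n : ℕ) → (Fin n → ℕ) → Poly n → Set
IAD n h f = InIdeal (ADgen n h) f

-- With 0-indexed j and h_j ≥ j + 1, show e_d(1,…,m) ∈ I_h^AD whenever h_j ≤ m ≤ n and m ≤ j + d,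
-- by induction on j and then on m.  For m > h_j use the recurrence
-- e_d(1,…,m) = e_d(1,…,m-1) + x_m e_{d-1}(1,…,m-1).  For m = h_j, the case d = h_j - j is the
-- j-th generator; a larger d is the claim for j - 1, since h_{j-1} ≤ h_j and h_j ≤ (j - 1) + d,
-- and for j = 0 it forces d > m, so e_d(1,…,m) = 0.  The theorem is the case j = i, m = d = h_i.
module Submission where

open import Defs
open import Data.Nat using (ℕ)
open import Data.Fin using (Fin)

open import Algebra.Bundles using (CommutativeMonoid)
import Algebra.Properties.CommutativeSemigroup as CommutativeSemigroupProperties
open import Data.Nat as ℕ using (zero; suc; _+_; _≤_; _<_; _∸_; s≤s)
import Data.Nat.Properties as ℕ
open import Data.Integer as ℤ using (ℤ; 0ℤ; 1ℤ)
import Data.Integer.Properties as ℤ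
open import Data.Fin as Fin using (toℕ; fromℕ<)
import Data.Fin.Properties as Fin
open import Data.Vec as Vec using (zipWith)
import Data.Vec.Properties as Vec
open import Data.List as List using (List; []; _∷_; _++_; _∷ʳ_; map; take; allFin; foldr; length)
import Data.List.Properties as List
open import Data.List.Relation.Binary.Permutation.Propositional
  using (_↭_; ↭-refl; ↭-reflexive; ↭-trans; ↭⇒↭ₛ; module PermutationReasoning)
import Data.List.Relation.Binary.Permutation.Propositional.Properties as Perm
import Data.List.Relation.Binary.Permutation.Setoid.Properties as Permₛ
open import Data.Product using (_×_; _,_; Σ)
open import Data.Sum using (inj₁; inj₂)
open import Data.Empty using (⊥-elim)
open import Function using (_∘_; id)
open import Relation.Nullary using (yes; no)
open import Relation.Binary.PropositionalEquality

module _ {n : ℕ} where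

  termCoeff : Mono n → ℤ × Mono n → ℤ
  termCoeff m (a , m′) with Vec.≡-dec ℕ._≟_ m′ m
  ... | yes _ = a
  ... | no  _ = 0ℤ

  coeff≡sum-termCoeff : ∀ (p : Poly n) m → coeff p m ≡ foldr ℤ._+_ 0ℤ (map (termCoeff m) p)
  coeff≡sum-termCoeff [] m = refl
  coeff≡sum-termCoeff ((a , m′) ∷ p) m with Vec.≡-dec ℕ._≟_ m′ m
  ... | yes _ = cong (ℤ._+_ a) (coeff≡sum-termCoeff p m)
  ... | no  _ = trans (coeff≡sum-termCoeff p m) (sym (ℤ.+-identityˡ _))

  coeff-↭ : ∀ {p q : Poly n} → p ↭ q → p ≈P q
  coeff-↭ {p} {q} p↭q m = begin
    coeff p m                              ≡⟨ coeff≡sum-termCoeff p m ⟩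
    foldr ℤ._+_ 0ℤ (map (termCoeff m) p)   ≡⟨ Permₛ.foldr-commMonoid (setoid ℤ) ℤ.+-0-isCommutativeMonoid
                                                (↭⇒↭ₛ (Perm.map⁺ (termCoeff m) p↭q)) ⟩
    foldr ℤ._+_ 0ℤ (map (termCoeff m) q)   ≡⟨ coeff≡sum-termCoeff q m ⟨
    coeff q m                              ∎
    where open ≡-Reasoning

  monomial : Mono n → Poly n
  monomial u = (1ℤ , u) ∷ []

  private
    -- The factor 1ℤ makes  monomial u *P p  compute to  map (shift u) p ++ [].
    shift : Mono n → ℤ × Mono n → ℤ × Mono n
    shift u (b , m) = (1ℤ ℤ.* b , zipWith _+_ u m)

    monomial-*P : ∀ u (p : Poly n) → monomial u *P p ≡ map (shift u) p
    monomial-*P u p = List.++-identityʳ (map (shift u) p)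

    +ᵛ-assoc : ∀ (u v w : Mono n) →
               zipWith _+_ (zipWith _+_ u v) w ≡ zipWith _+_ u (zipWith _+_ v w)
    +ᵛ-assoc = Vec.zipWith-assoc ℕ.+-assoc

    +ᵛ-leftComm : ∀ (u v w : Mono n) →
                  zipWith _+_ u (zipWith _+_ v w) ≡ zipWith _+_ v (zipWith _+_ u w)
    +ᵛ-leftComm u v w = begin
      zipWith _+_ u (zipWith _+_ v w) ≡⟨ +ᵛ-assoc u v w ⟨
      zipWith _+_ (zipWith _+_ u v) w ≡⟨ cong (λ x → zipWith _+_ x w) (Vec.zipWith-comm ℕ.+-comm u v) ⟩
      zipWith _+_ (zipWith _+_ v u) w ≡⟨ +ᵛ-assoc v u w ⟩
      zipWith _+_ v (zipWith _+_ u w) ∎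
      where open ≡-Reasoning

    term*P : ℤ × Mono n → Poly n → Poly n
    term*P (a , m) q = map (λ { (b , m′) → (a ℤ.* b , zipWith _+_ m m′) }) q

    shift-term*P : ∀ u t (q : Poly n) → map (shift u) (term*P t q) ≡ term*P (shift u t) q
    shift-term*P u (a , m) q = trans (sym (List.map-∘ q))
      (List.map-cong (λ { (b , m′) → cong₂ _,_ (sym (ℤ.*-assoc 1ℤ a b)) (sym (+ᵛ-assoc u m m′)) }) q)

    shift-*P : ∀ u (p q : Poly n) → map (shift u) (p *P q) ≡ map (shift u) p *P q
    shift-*P u [] q = refl
    shift-*P u (t ∷ p) q = begin
      map (shift u) (term*P t q ++ p *P q)               ≡⟨ List.map-++ (shift u) (term*P t q) (p *P q) ⟩
      map (shift u) (term*P t q) ++ map (shift u) (p *P q) ≡⟨ cong₂ _++_ (shift-term*P u t q) (shift-*P u p q) ⟩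
      term*P (shift u t) q ++ map (shift u) p *P q       ∎
      where open ≡-Reasoning

  monomial-*P-distribˡ-++ : ∀ u (p q : Poly n) →
                            monomial u *P (p ++ q) ≡ monomial u *P p ++ monomial u *P q
  monomial-*P-distribˡ-++ u p q = begin
    monomial u *P (p ++ q)                 ≡⟨ monomial-*P u (p ++ q) ⟩
    map (shift u) (p ++ q)                 ≡⟨ List.map-++ (shift u) p q ⟩
    map (shift u) p ++ map (shift u) q     ≡⟨ cong₂ _++_ (monomial-*P u p) (monomial-*P u q) ⟨
    monomial u *P p ++ monomial u *P q     ∎
    where open ≡-Reasoning

  monomial-*P-assoc : ∀ u (p q : Poly n) → monomial u *P (p *P q) ≡ (monomial u *P p) *P q
  monomial-*P-assoc u p q = begin
    monomial u *P (p *P q)     ≡⟨ monomial-*P u (p *P q) ⟩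
    map (shift u) (p *P q)     ≡⟨ shift-*P u p q ⟩
    map (shift u) p *P q       ≡⟨ cong (_*P q) (monomial-*P u p) ⟨
    (monomial u *P p) *P q     ∎
    where open ≡-Reasoning

  monomial-*P-comm : ∀ u v (p : Poly n) →
                     monomial u *P (monomial v *P p) ≡ monomial v *P (monomial u *P p)
  monomial-*P-comm u v p = begin
    monomial u *P (monomial v *P p)    ≡⟨ trans (monomial-*P u _) (cong (map (shift u)) (monomial-*P v p)) ⟩
    map (shift u) (map (shift v) p)    ≡⟨ List.map-∘ p ⟨
    map (shift u ∘ shift v) p          ≡⟨ List.map-cong (λ { (b , m) → cong₂ _,_ refl (+ᵛ-leftComm u v m) }) p ⟩
    map (shift v ∘ shift u) p          ≡⟨ List.map-∘ p ⟩
    map (shift v) (map (shift u) p)    ≡⟨ trans (monomial-*P v _) (cong (map (shift v)) (monomial-*P u p)) ⟨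
    monomial v *P (monomial u *P p)    ∎
    where open ≡-Reasoning

  1P-*P-identityˡ : ∀ (p : Poly n) → 1P *P p ≡ p
  1P-*P-identityˡ p = begin
    1P *P p                          ≡⟨ monomial-*P _ p ⟩
    map (shift (Vec.replicate n 0)) p ≡⟨ List.map-cong (λ { (b , m) → cong₂ _,_ (ℤ.*-identityˡ b)
                                           (Vec.zipWith-identityˡ ℕ.+-identityˡ m) }) p ⟩
    map id p                         ≡⟨ List.map-id p ⟩
    p                                ∎
    where open ≡-Reasoning

  monomial-*P-↭ : ∀ u {p q : Poly n} → p ↭ q → monomial u *P p ↭ monomial u *P q
  monomial-*P-↭ u {p} {q} p↭q = begin
    monomial u *P p   ≡⟨ monomial-*P u p ⟩
    map (shift u) p   ↭⟨ Perm.map⁺ (shift u) p↭q ⟩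
    map (shift u) q   ≡⟨ monomial-*P u q ⟨
    monomial u *P q   ∎
    where open PermutationReasoning

  *P-distribʳ-++ : ∀ (p q r : Poly n) → (p ++ q) *P r ≡ p *P r ++ q *P r
  *P-distribʳ-++ p q r = List.concatMap-++ _ p q

  open CommutativeSemigroupProperties
    (CommutativeMonoid.commutativeSemigroup (Perm.++-commutativeMonoid {A = ℤ × Mono n}))
    using (interchange; xy∙z≈xz∙y)

  esym-∷ʳ : ∀ d (xs : List (Fin n)) y →
            esym (suc d) (xs ∷ʳ y) ↭ esym (suc d) xs ++ var y *P esym d xs
  esym-∷ʳ d [] y = ↭-refl
  esym-∷ʳ zero (x ∷ xs) y = begin
    esym 1 (xs ∷ʳ y) ++ var x *P 1P                   ↭⟨ Perm.++⁺ʳ (var x *P 1P) (esym-∷ʳ zero xs y) ⟩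
    (esym 1 xs ++ var y *P 1P) ++ var x *P 1P         ↭⟨ xy∙z≈xz∙y (esym 1 xs) (var y *P 1P) (var x *P 1P) ⟩
    (esym 1 xs ++ var x *P 1P) ++ var y *P 1P         ∎
    where open PermutationReasoning
  esym-∷ʳ (suc d) (x ∷ xs) y = begin
    esym (2 + d) (xs ∷ʳ y) ++ X (esym (suc d) (xs ∷ʳ y))
      ↭⟨ Perm.++⁺ (esym-∷ʳ (suc d) xs y) (monomial-*P-↭ _ (esym-∷ʳ d xs y)) ⟩
    (E₂ ++ Y E₁) ++ X (E₁ ++ Y E₀)
      ≡⟨ cong ((E₂ ++ Y E₁) ++_) (monomial-*P-distribˡ-++ _ E₁ (Y E₀)) ⟩
    (E₂ ++ Y E₁) ++ (X E₁ ++ X (Y E₀))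
      ↭⟨ interchange E₂ (Y E₁) (X E₁) (X (Y E₀)) ⟩
    (E₂ ++ X E₁) ++ (Y E₁ ++ X (Y E₀))
      ≡⟨ cong (λ z → (E₂ ++ X E₁) ++ (Y E₁ ++ z)) (monomial-*P-comm _ _ E₀) ⟩
    (E₂ ++ X E₁) ++ (Y E₁ ++ Y (X E₀))
      ≡⟨ cong ((E₂ ++ X E₁) ++_) (monomial-*P-distribˡ-++ _ E₁ (X E₀)) ⟨
    (E₂ ++ X E₁) ++ Y (E₁ ++ X E₀) ∎
    where
    open PermutationReasoning
    X Y : Poly n → Poly n
    X = var x *P_
    Y = var y *P_
    E₀ E₁ E₂ : Poly n
    E₀ = esym d xs
    E₁ = esym (suc d) xs
    E₂ = esym (2 + d) xs

  esym-vanish : ∀ d (xs : List (Fin n)) → length xs < d → esym d xs ≡ []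
  esym-vanish (suc d) [] _ = refl
  esym-vanish (suc d) (x ∷ xs) (s≤s |xs|≤d) =
    cong₂ _++_ (esym-vanish (suc d) xs (ℕ.m≤n⇒m≤1+n |xs|≤d)) (cong (var x *P_) (esym-vanish d xs |xs|≤d))

  sumOver : ∀ {k} → List (Fin k) → (Fin k → Poly n) → Poly n
  sumOver js f = foldr (λ j acc → f j +P acc) 0P js

  sumOver-[] : ∀ {k} (js : List (Fin k)) → sumOver js (λ _ → []) ≡ []
  sumOver-[] []       = refl
  sumOver-[] (_ ∷ js) = sumOver-[] js

  sumOver-cong : ∀ {k} (js : List (Fin k)) {f g : Fin k → Poly n} →
                 (∀ j → f j ≡ g j) → sumOver js f ≡ sumOver js g
  sumOver-cong []       f≗g = refl
  sumOver-cong (j ∷ js) f≗g = cong₂ _++_ (f≗g j) (sumOver-cong js f≗g)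

  sumOver-++ : ∀ {k} (js : List (Fin k)) (f g : Fin k → Poly n) →
               sumOver js (λ j → f j ++ g j) ↭ sumOver js f ++ sumOver js g
  sumOver-++ []       f g = ↭-refl
  sumOver-++ (j ∷ js) f g = ↭-trans (Perm.++⁺ˡ (f j ++ g j) (sumOver-++ js f g))
                                    (interchange (f j) (g j) (sumOver js f) (sumOver js g))

  monomial-*P-sumOver : ∀ u {k} (js : List (Fin k)) (f : Fin k → Poly n) →
                        monomial u *P sumOver js f ≡ sumOver js (λ j → monomial u *P f j)
  monomial-*P-sumOver u []       f = refl
  monomial-*P-sumOver u (j ∷ js) f =
    trans (monomial-*P-distribˡ-++ u (f j) (sumOver js f))
          (cong (monomial u *P f j ++_) (monomial-*P-sumOver u js f))

  ΣP-suc : ∀ {k} (f : Fin (suc k) → Poly n) → ΣP f ≡ f Fin.zero ++ ΣP (f ∘ Fin.suc)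
  ΣP-suc {k} f = cong (f Fin.zero ++_) (begin
    sumOver (List.tabulate Fin.suc) f          ≡⟨ cong (λ js → sumOver js f) (List.map-tabulate id Fin.suc) ⟨
    sumOver (map Fin.suc (allFin k)) f         ≡⟨ List.foldr-map _ Fin.suc [] (allFin k) ⟩
    ΣP (f ∘ Fin.suc)                           ∎)
    where open ≡-Reasoning

  δ : ∀ {k} → Fin k → Fin k → Poly n
  δ Fin.zero    Fin.zero    = 1P
  δ Fin.zero    (Fin.suc _) = []
  δ (Fin.suc _) Fin.zero    = []
  δ (Fin.suc i) (Fin.suc j) = δ i j

  ΣP-δ : ∀ {k} (g : Fin k → Poly n) i → ΣP (λ j → δ i j *P g j) ≡ g i
  ΣP-δ {suc k} g Fin.zero = begin
    ΣP (λ j → δ Fin.zero j *P g j)       ≡⟨ ΣP-suc (λ j → δ Fin.zero j *P g j) ⟩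
    1P *P g Fin.zero ++ ΣP {k = k} (λ _ → []) ≡⟨ cong₂ _++_ (1P-*P-identityˡ (g Fin.zero))
                                                             (sumOver-[] (allFin k)) ⟩
    g Fin.zero ++ []                     ≡⟨ List.++-identityʳ (g Fin.zero) ⟩
    g Fin.zero                           ∎
    where open ≡-Reasoning
  ΣP-δ {suc k} g (Fin.suc i) =
    trans (ΣP-suc (λ j → δ (Fin.suc i) j *P g j)) (ΣP-δ (g ∘ Fin.suc) i)

  -- Ideal membership up to a permutation of the terms: finer than ≈P, and respected by the
  -- list operations underlying +P and *P, so no coefficient bookkeeping is needed.
  infix 4 _∈⟨_⟩
  _∈⟨_⟩ : ∀ {k} → Poly n → (Fin k → Poly n) → Set
  f ∈⟨ g ⟩ = Σ (Fin _ → Poly n) λ c → f ↭ ΣP (λ j → c j *P g j)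

  module _ {k} {g : Fin k → Poly n} where

    ∈⟨⟩-resp-↭ : ∀ {f f′} → f ↭ f′ → f′ ∈⟨ g ⟩ → f ∈⟨ g ⟩
    ∈⟨⟩-resp-↭ f↭f′ (c , f′↭Σ) = c , ↭-trans f↭f′ f′↭Σ

    []∈⟨⟩ : [] ∈⟨ g ⟩
    []∈⟨⟩ = (λ _ → []) , ↭-reflexive (sym (sumOver-[] (allFin k)))

    generator∈⟨⟩ : ∀ i → g i ∈⟨ g ⟩
    generator∈⟨⟩ i = δ i , ↭-reflexive (sym (ΣP-δ g i))

    ∈⟨⟩-++ : ∀ {f f′} → f ∈⟨ g ⟩ → f′ ∈⟨ g ⟩ → f ++ f′ ∈⟨ g ⟩
    ∈⟨⟩-++ {f} {f′} (c , f↭Σ) (c′ , f′↭Σ) = (λ j → c j ++ c′ j) , (begin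
      f ++ f′                                             ↭⟨ Perm.++⁺ f↭Σ f′↭Σ ⟩
      ΣP (λ j → c j *P g j) ++ ΣP (λ j → c′ j *P g j)     ↭⟨ sumOver-++ (allFin k) _ _ ⟨
      ΣP (λ j → c j *P g j ++ c′ j *P g j)
        ≡⟨ sumOver-cong (allFin k) (λ j → *P-distribʳ-++ (c j) (c′ j) (g j)) ⟨
      ΣP (λ j → (c j ++ c′ j) *P g j)                     ∎)
      where open PermutationReasoning

    monomial-*P-∈⟨⟩ : ∀ u {f} → f ∈⟨ g ⟩ → monomial u *P f ∈⟨ g ⟩
    monomial-*P-∈⟨⟩ u {f} (c , f↭Σ) = (λ j → monomial u *P c j) , (begin
      monomial u *P f                                 ↭⟨ monomial-*P-↭ u f↭Σ ⟩
      monomial u *P ΣP (λ j → c j *P g j)             ≡⟨ monomial-*P-sumOver u (allFin k) _ ⟩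
      ΣP (λ j → monomial u *P (c j *P g j))
        ≡⟨ sumOver-cong (allFin k) (λ j → monomial-*P-assoc u (c j) (g j)) ⟩
      ΣP (λ j → (monomial u *P c j) *P g j)           ∎)
      where open PermutationReasoning

    ∈⟨⟩⇒InIdeal : ∀ {f} → f ∈⟨ g ⟩ → InIdeal g f
    ∈⟨⟩⇒InIdeal (c , f↭Σ) = c , coeff-↭ f↭Σ

  take-suc-allFin : ∀ {m} (m<n : m < n) → take (suc m) (allFin n) ≡ take m (allFin n) ∷ʳ fromℕ< m<n
  take-suc-allFin {m} m<n = subst (λ k → take (suc k) (allFin n) ≡ take k (allFin n) ∷ʳ fromℕ< m<n)
                                  (Fin.toℕ-fromℕ< m<n) (List.take-suc-tabulate id (fromℕ< m<n))

  e-suc : ∀ {m} (m<n : m < n) d → e (suc d) (suc m) ↭ e (suc d) m ++ var (fromℕ< m<n) *P e d m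
  e-suc {m} m<n d = ↭-trans (↭-reflexive (cong (esym (suc d)) (take-suc-allFin m<n)))
                            (esym-∷ʳ d (take m (allFin n)) (fromℕ< m<n))

  e-vanish : ∀ {d m} → m < d → e d m ≡ []
  e-vanish {d} {m} m<d = esym-vanish d _ (ℕ.≤-<-trans |take|≤m m<d)
    where
    |take|≤m : length (take m (allFin n)) ≤ m
    |take|≤m = ℕ.≤-trans (ℕ.≤-reflexive (List.length-take m (allFin n))) (ℕ.m⊓n≤m m _)

module _ {n : ℕ} {h : Fin n → ℕ} (hess : IsHessenberg n h) where
  open IsHessenberg hess

  hᴺ : ∀ j → .(j < n) → ℕ
  hᴺ j j<n = h (fromℕ< j<n)

  hᴺ-lower : ∀ {j} (j<n : j < n) → j < hᴺ j j<n
  hᴺ-lower j<n = subst (λ k → suc k ≤ hᴺ _ j<n) (Fin.toℕ-fromℕ< j<n) (lower (fromℕ< j<n))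

  hᴺ-mono : ∀ {j} (1+j<n : suc j < n) → hᴺ j (ℕ.<-trans (ℕ.n<1+n j) 1+j<n) ≤ hᴺ (suc j) 1+j<n
  hᴺ-mono {j} 1+j<n = subst (λ i → h (fromℕ< j<n) ≤ h i)
                            (Fin.fromℕ<-cong _ _ (cong suc (Fin.toℕ-fromℕ< j<n)) 1+i<n 1+j<n)
                            (mono (fromℕ< j<n) 1+i<n)
    where
    j<n : j < n
    j<n = ℕ.<-trans (ℕ.n<1+n j) 1+j<n
    1+i<n : suc (toℕ (fromℕ< j<n)) < n
    1+i<n = subst (λ k → suc k < n) (sym (Fin.toℕ-fromℕ< j<n)) 1+j<n

  ADgen-fromℕ< : ∀ {j} (j<n : j < n) → ADgen n h (fromℕ< j<n) ≡ e (hᴺ j j<n ∸ j) (hᴺ j j<n)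
  ADgen-fromℕ< j<n = cong (λ k → e (hᴺ _ j<n ∸ k) (hᴺ _ j<n)) (Fin.toℕ-fromℕ< j<n)

  mutual
    e∈IAD : ∀ j (j<n : j < n) m → hᴺ j j<n ≤ m → m ≤ n → ∀ d → m ≤ j + d → e d m ∈⟨ ADgen n h ⟩
    e∈IAD j j<n m hⱼ≤m m≤n d m≤j+d with ℕ.m≤n⇒m<n∨m≡n hⱼ≤m
    ... | inj₁ hⱼ<m = e∈IAD-above j j<n hⱼ<m m≤n d m≤j+d
    ... | inj₂ refl = e∈IAD-at j j<n m≤n d m≤j+d

    e∈IAD-above : ∀ j (j<n : j < n) {m} → hᴺ j j<n < m → m ≤ n →
                  ∀ d → m ≤ j + d → e d m ∈⟨ ADgen n h ⟩
    e∈IAD-above j j<n {suc m} hⱼ<m m≤n zero m≤j+0 =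
      ⊥-elim (ℕ.<-irrefl refl (ℕ.<-≤-trans (ℕ.<-trans (hᴺ-lower j<n) hⱼ<m)
                                            (subst (suc m ≤_) (ℕ.+-identityʳ j) m≤j+0)))
    e∈IAD-above j j<n {suc m} (s≤s hⱼ≤m) m≤n (suc d) m≤j+d =
      ∈⟨⟩-resp-↭ (e-suc m≤n d)
        (∈⟨⟩-++ (e∈IAD j j<n m hⱼ≤m (ℕ.<⇒≤ m≤n) (suc d) (ℕ.<⇒≤ m≤j+d))
                (monomial-*P-∈⟨⟩ _ (e∈IAD j j<n m hⱼ≤m (ℕ.<⇒≤ m≤n) d m≤j+d′)))
      where
      m≤j+d′ : m ≤ j + d
      m≤j+d′ = ℕ.s≤s⁻¹ (subst (suc m ≤_) (ℕ.+-suc j d) m≤j+d)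

    e∈IAD-at : ∀ j (j<n : j < n) → hᴺ j j<n ≤ n →
               ∀ d → hᴺ j j<n ≤ j + d → e d (hᴺ j j<n) ∈⟨ ADgen n h ⟩
    e∈IAD-at j j<n hⱼ≤n d hⱼ≤j+d with hᴺ j j<n ℕ.≟ j + d
    ... | yes hⱼ≡j+d = subst (_∈⟨ ADgen n h ⟩) generator≡e (generator∈⟨⟩ (fromℕ< j<n))
      where
      generator≡e : ADgen n h (fromℕ< j<n) ≡ e d (hᴺ j j<n)
      generator≡e = trans (ADgen-fromℕ< j<n)
                          (cong (λ k → e k (hᴺ j j<n)) (trans (cong (_∸ j) hⱼ≡j+d) (ℕ.m+n∸m≡n j d)))
    ... | no hⱼ≢j+d = e∈IAD-below j j<n hⱼ≤n d (ℕ.≤∧≢⇒< hⱼ≤j+d hⱼ≢j+d)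

    e∈IAD-below : ∀ j (j<n : j < n) → hᴺ j j<n ≤ n →
                  ∀ d → hᴺ j j<n < j + d → e d (hᴺ j j<n) ∈⟨ ADgen n h ⟩
    e∈IAD-below zero     j<n hⱼ≤n d hⱼ<d   = subst (_∈⟨ ADgen n h ⟩) (sym (e-vanish hⱼ<d)) []∈⟨⟩
    e∈IAD-below (suc j) 1+j<n hⱼ≤n d hⱼ<1+j+d =
      e∈IAD j (ℕ.<-trans (ℕ.n<1+n j) 1+j<n) (hᴺ (suc j) 1+j<n) (hᴺ-mono 1+j<n) hⱼ≤n
            d (ℕ.s≤s⁻¹ hⱼ<1+j+d)

lemma4p15 : (n : ℕ) (h : Fin n → ℕ) → IsHessenberg n h →
            (i : Fin n) → IAD n h (e (h i) (h i))
lemma4p15 n h hess i = ∈⟨⟩⇒InIdeal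
  (e∈IAD hess (toℕ i) i<n (h i) hᵢ≤hᵢ (IsHessenberg.upper hess i) (h i) (ℕ.m≤n+m (h i) (toℕ i)))
  where
  i<n : toℕ i < n
  i<n = Fin.toℕ<n i
  hᵢ≤hᵢ : h (fromℕ< i<n) ≤ h i
  hᵢ≤hᵢ = ℕ.≤-reflexive (cong h (Fin.fromℕ<-toℕ i i<n))
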